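{- Let $X\subseteq\mathbb{R}^n$. Then $F_{\min}(X)=\bigcap_{j=1}^n F_j$, where $F_j=X-\mathbb{L}_j=\{x-z\mid x\in X,\ z\in\mathbb{L}_j\}$.
   Context: $\mathbb{R}_+^n=\{z\in\mathbb{R}^n\mid z_i\ge0\ \forall i\}$ and $\mathbb{L}_j=\{z\in\mathbb{R}_+^n\mid z_j=0\}$ for $1\le j\le n$. For a finite nonempty $P\subseteq\mathbb{R}^n$, $f_{\min}(P)$ is the coordinatewise minimum of $P$; $F_{\min}(X)=\{f_{\min}(P)\mid P\text{ a finite nonempty subset of } X\}$. -}

module Defs where

open import Level using (0ℓ)
open import Data.Nat using (ℕ)
open import Data.Fin using (Fin)
open import Data.List using (List; foldr; map)
open import Data.List.Relation.Unary.All using (All)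
open import Data.Product using (Σ; ∃; _×_; _,_)
open import Relation.Nullary using (¬_)
open import Relation.Binary.PropositionalEquality using (_≡_)
open import Relation.Binary.Structures using (IsTotalOrder)
open import Algebra.Structures using (IsCommutativeRing)

-- An axiomatisation of the real numbers: a complete (Dedekind, via least
-- upper bounds) totally ordered field, with equality taken to be _≡_.
-- Such a structure is unique up to isomorphism, so it is ℝ.
record Reals : Set₁ where
  infixl 6 _+_
  infixl 7 _*_
  infix  4 _≤_
  infixl 7 _⊓_
  field
    ℝ   : Set
    _+_ : ℝ → ℝ → ℝ
    _*_ : ℝ → ℝ → ℝ
    -_  : ℝ → ℝ
    0ℝ  : ℝ
    1ℝ  : ℝ
    _≤_ : ℝ → ℝ → Set
    isCommutativeRing : IsCommutativeRing _≡_ _+_ _*_ -_ 0ℝ 1ℝ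
    0≢1 : ¬ (0ℝ ≡ 1ℝ)
    *-inverse : ∀ x → ¬ (x ≡ 0ℝ) → ∃ λ y → x * y ≡ 1ℝ
    isTotalOrder : IsTotalOrder _≡_ _≤_
    +-mono-≤ : ∀ {x y} z → x ≤ y → x + z ≤ y + z
    *-nonneg : ∀ {x y} → 0ℝ ≤ x → 0ℝ ≤ y → 0ℝ ≤ x * y
    sup : (S : ℝ → Set) → ∃ S → (∃ λ b → ∀ s → S s → s ≤ b) →
          ∃ λ u → (∀ s → S s → s ≤ u) × (∀ b → (∀ s → S s → s ≤ b) → u ≤ b)
    _⊓_ : ℝ → ℝ → ℝ
    ⊓-left  : ∀ {x y} → x ≤ y → x ⊓ y ≡ x
    ⊓-right : ∀ {x y} → y ≤ x → x ⊓ y ≡ y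

  _-_ : ℝ → ℝ → ℝ
  x - y = x + (- y)

module _ (R : Reals) where
  open Reals R

  Pt : ℕ → Set
  Pt n = Fin n → ℝ

  nonneg : ∀ {n} → Pt n → Set
  nonneg z = ∀ i → 0ℝ ≤ z i

  𝕃 : ∀ {n} → Fin n → Pt n → Set
  𝕃 j z = nonneg z × (z j ≡ 0ℝ)

  fmin : ∀ {n} → Pt n → List (Pt n) → Pt n
  fmin p ps i = foldr _⊓_ (p i) (map (λ q → q i) ps)

  -- y ∈ F_min(X): y = f_min(P) for some finite nonempty P ⊆ X
  -- (P given as a nonempty list p ∷ ps of points of X)
  InFmin : ∀ {n} → (Pt n → Set) → Pt n → Set
  InFmin X y = Σ _ λ p → Σ (List _) λ ps →
    X p × All X ps × (∀ i → fmin p ps i ≡ y i)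

  InF : ∀ {n} → (Pt n → Set) → Fin n → Pt n → Set
  InF X j y = Σ _ λ x → Σ _ λ z → X x × 𝕃 j z × (∀ i → y i ≡ x i - z i)

-- A point y lies in X − 𝕃ⱼ exactly when some x ∈ X lies above y and agrees with
-- it in coordinate j (take z = x − y). The coordinatewise minimum of a finite
-- P ⊆ X is attained in every coordinate j by some point of P, which therefore
-- witnesses membership in every Fⱼ. Conversely, choosing one such witness xⱼ
-- for each j, the set P = {x₁, …, xₙ} lies above y and meets y in every
-- coordinate, so its minimum is y.
module Submission where

open import Defs
open import Data.Nat using (ℕ; suc)
open import Data.Fin using (Fin; zero; suc)
open import Data.Product using (_×_; _,_; ∃)
open import Data.Sum using (_⊎_; inj₁; inj₂)
open import Data.List using ([]; _∷_; foldr; map; tabulate)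
open import Data.List.Relation.Unary.All as All using (_∷_)
open import Data.List.Relation.Unary.All.Properties using (tabulate⁺)
open import Data.List.Relation.Unary.Any using (here; there)
open import Data.List.Membership.Propositional using (_∈_)
open import Data.List.Membership.Propositional.Properties
  using (∈-map⁺; ∈-map⁻; ∈-tabulate⁺; ∈-tabulate⁻)
open import Function using (_∘_)
open import Relation.Binary.PropositionalEquality
open import Relation.Binary.Structures using (IsTotalOrder)
open import Algebra.Bundles using (CommutativeRing)
import Algebra.Properties.AbelianGroup as AbelianGroupProperties

module _ (R : Reals) where
  open Reals R

  commutativeRing : CommutativeRing _ _
  commutativeRing = record { isCommutativeRing = isCommutativeRing }

  open CommutativeRing commutativeRing using (+-abelianGroup; +-comm; +-identityˡ; +-identityʳ; -‿inverseʳ)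
  open AbelianGroupProperties +-abelianGroup
    using (⁻¹-anti-homo-//; //-rightDividesˡ; ε⁻¹≈ε; x≈y⇒x∙y⁻¹≈ε)
  open IsTotalOrder isTotalOrder using (total; antisym) renaming (refl to ≤-refl; trans to ≤-trans)
  open ≡-Reasoning

  x-[x-y]≡y : ∀ x y → x - (x - y) ≡ y
  x-[x-y]≡y x y = begin
    x - (x - y)   ≡⟨ cong (x +_) (⁻¹-anti-homo-// x y) ⟩
    x + (y - x)   ≡⟨ +-comm x (y - x) ⟩
    (y - x) + x   ≡⟨ //-rightDividesˡ x y ⟩
    y             ∎

  x-0≡x : ∀ x → x - 0ℝ ≡ x
  x-0≡x x = trans (cong (x +_) ε⁻¹≈ε) (+-identityʳ x)

  y≤x⇒0≤x-y : ∀ {x y} → y ≤ x → 0ℝ ≤ x - y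
  y≤x⇒0≤x-y {x} {y} y≤x = subst (_≤ x - y) (-‿inverseʳ y) (+-mono-≤ (- y) y≤x)

  0≤z⇒x-z≤x : ∀ {x z} → 0ℝ ≤ z → x - z ≤ x
  0≤z⇒x-z≤x {x} {z} 0≤z =
    subst₂ _≤_ (+-identityˡ (x - z)) (trans (+-comm z (x - z)) (//-rightDividesˡ z x))
      (+-mono-≤ (x - z) 0≤z)

  x⊓y≤x : ∀ x y → x ⊓ y ≤ x
  x⊓y≤x x y with total x y
  ... | inj₁ x≤y = subst (_≤ x) (sym (⊓-left x≤y)) ≤-refl
  ... | inj₂ y≤x = subst (_≤ x) (sym (⊓-right y≤x)) y≤x

  x⊓y≤y : ∀ x y → x ⊓ y ≤ y
  x⊓y≤y x y with total x y
  ... | inj₁ x≤y = subst (_≤ y) (sym (⊓-left x≤y)) x≤y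
  ... | inj₂ y≤x = subst (_≤ y) (sym (⊓-right y≤x)) ≤-refl

  ⊓-sel : ∀ x y → x ⊓ y ≡ x ⊎ x ⊓ y ≡ y
  ⊓-sel x y with total x y
  ... | inj₁ x≤y = inj₁ (⊓-left x≤y)
  ... | inj₂ y≤x = inj₂ (⊓-right y≤x)

  foldr-⊓-≤ : ∀ {a x} xs → x ∈ a ∷ xs → foldr _⊓_ a xs ≤ x
  foldr-⊓-≤ []       (here refl)          = ≤-refl
  foldr-⊓-≤ (b ∷ xs) (there (here refl))  = x⊓y≤x b _
  foldr-⊓-≤ (b ∷ xs) (here refl)          = ≤-trans (x⊓y≤y b _) (foldr-⊓-≤ xs (here refl))
  foldr-⊓-≤ (b ∷ xs) (there (there x∈xs)) = ≤-trans (x⊓y≤y b _) (foldr-⊓-≤ xs (there x∈xs))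

  foldr-⊓-∈ : ∀ a xs → foldr _⊓_ a xs ∈ a ∷ xs
  foldr-⊓-∈ a []       = here refl
  foldr-⊓-∈ a (b ∷ xs) with ⊓-sel b (foldr _⊓_ a xs) | foldr-⊓-∈ a xs
  ... | inj₁ ⊓≡b | _         rewrite ⊓≡b = there (here refl)
  ... | inj₂ ⊓≡m | here m≡a  rewrite ⊓≡m = here m≡a
  ... | inj₂ ⊓≡m | there m∈ rewrite ⊓≡m = there (there m∈)

  module _ {n : ℕ} where

    fmin-≤ : ∀ {p : Pt R n} {ps q} i → q ∈ p ∷ ps → fmin R p ps i ≤ q i
    fmin-≤ {ps = ps} i q∈ = foldr-⊓-≤ (map (λ r → r i) ps) (∈-map⁺ (λ r → r i) q∈)

    fmin-attained : ∀ (p : Pt R n) ps i → ∃ λ q → q ∈ p ∷ ps × fmin R p ps i ≡ q i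
    fmin-attained p ps i = ∈-map⁻ (λ r → r i) (foldr-⊓-∈ (p i) (map (λ r → r i) ps))

    fmin-unique : ∀ {p : Pt R n} {ps} {y : Pt R n} →
      (∀ {q} → q ∈ p ∷ ps → ∀ i → y i ≤ q i) →
      (∀ i → ∃ λ q → q ∈ p ∷ ps × q i ≡ y i) →
      ∀ i → fmin R p ps i ≡ y i
    fmin-unique {p} {ps} {y} below attained i with attained i | fmin-attained p ps i
    ... | q , q∈ , qᵢ≡yᵢ | r , r∈ , fminᵢ≡rᵢ = antisym
      (subst (fmin R p ps i ≤_) qᵢ≡yᵢ (fmin-≤ i q∈))
      (subst (y i ≤_) (sym fminᵢ≡rᵢ) (below r∈ i))

    record Dominator (X : Pt R n → Set) (j : Fin n) (y : Pt R n) : Set where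
      field
        point   : Pt R n
        member  : X point
        above   : ∀ i → y i ≤ point i
        touches : point j ≡ y j

    open Dominator

    InF⁺ : ∀ {X j y} → Dominator X j y → InF R X j y
    InF⁺ {y = y} d = x , (λ i → x i - y i) , member d ,
      ((λ i → y≤x⇒0≤x-y (above d i)) , x≈y⇒x∙y⁻¹≈ε (touches d)) ,
      (λ i → sym (x-[x-y]≡y (x i) (y i)))
      where
      x : Pt R n
      x = point d

    InF⁻ : ∀ {X j y} → InF R X j y → Dominator X j y
    InF⁻ {j = j} {y} (x , z , x∈X , (0≤z , zⱼ≡0) , y≡x-z) = record
      { point   = x
      ; member  = x∈X
      ; above   = λ i → subst (_≤ x i) (sym (y≡x-z i)) (0≤z⇒x-z≤x (0≤z i))
      ; touches = sym (begin
          y j        ≡⟨ y≡x-z j ⟩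
          x j - z j  ≡⟨ cong (λ t → x j - t) zⱼ≡0 ⟩
          x j - 0ℝ   ≡⟨ x-0≡x (x j) ⟩
          x j        ∎)
      }

    InFmin⇒InF : ∀ {X y} → InFmin R X y → ∀ j → InF R X j y
    InFmin⇒InF {y = y} (p , ps , p∈X , ps⊆X , fmin≡y) j with fmin-attained p ps j
    ... | q , q∈ , fminⱼ≡qⱼ = InF⁺ record
      { point   = q
      ; member  = All.lookup (p∈X ∷ ps⊆X) q∈
      ; above   = λ i → subst (_≤ q i) (fmin≡y i) (fmin-≤ i q∈)
      ; touches = trans (sym fminⱼ≡qⱼ) (fmin≡y j)
      }

  -- P = {x_j} is listed as x zero ∷ tabulate (x ∘ suc), which is tabulate x by definition.
  InF⇒InFmin : ∀ {n X} {y : Pt R (suc n)} → (∀ j → InF R X j y) → InFmin R X y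
  InF⇒InFmin {n} {X} {y} y∈F =
    x zero , tabulate (x ∘ suc) , member (d zero) , tabulate⁺ (member ∘ d ∘ suc) ,
    fmin-unique below (λ i → x i , ∈-tabulate⁺ {f = x} i , touches (d i))
    where
    open Dominator
    d : ∀ j → Dominator X j y
    d j = InF⁻ (y∈F j)
    x : Fin (suc n) → Pt R (suc n)
    x = point ∘ d
    below : ∀ {q} → q ∈ tabulate x → ∀ i → y i ≤ q i
    below q∈ i with ∈-tabulate⁻ {f = x} q∈
    ... | j , refl = above (d j) i

lemma7 : (R : Reals) → (n : ℕ) → (X : (Fin (suc n) → Reals.ℝ R) → Set) →
    (y : Fin (suc n) → Reals.ℝ R) →
    (InFmin R X y → (∀ j → InF R X j y)) × ((∀ j → InF R X j y) → InFmin R X y)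
lemma7 R n X y = InFmin⇒InF R , InF⇒InFmin R
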